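{- For a peg permutation $\tilde\rho$, the following are equivalent: (1) $\tilde\rho$ is compact; (2) $\tilde\rho$ has no two positionally adjacent entries $\tilde\rho_i,\tilde\rho_{i+1}$ forming an interval order-isomorphic to one of $\oplus1\oplus2$, $\oplus1\bullet2$, $\bullet1\oplus2$, $\ominus2\ominus1$, $\ominus2\bullet1$, $\bullet2\ominus1$ (that is, either $\rho_{i+1}=\rho_i+1$ with decorations $(+,+)$, $(+,\bullet)$ or $(\bullet,+)$, or $\rho_{i+1}=\rho_i-1$ with decorations $(-,-)$, $(-,\bullet)$ or $(\bullet,-)$); (3) every permutation $\pi$ which fills $\tilde\rho$ has a unique vector $\vec v$ for which $\tilde\rho(\vec v)=\pi$.
   Context: A peg permutation $\tilde\rho$ of length $m$ is a permutation $\rho=\rho_1\cdots\rho_m$ in which each entry is decorated with $+$, $-$, or $\bullet$. For $\vec v=(v_1,\dots,v_m)\in\mathbb{Z}_{\ge0}^m$ with $v_i\in\{0,1\}$ whenever $\rho_i$ is decorated $\bullet$, the inflation $\tilde\rho(\vec v)$ is the permutation obtained by replacing entry $\rho_i$ by an interval of $v_i$ entries (an increasing run if decorated $+$, a decreasing run if decorated $-$, a single entry if decorated $\bullet$ and $v_i=1$; the entry is deleted if $v_i=0$), keeping the relative order of the blocks as in $\rho$, and standardizing. $\mathcal{I}(\tilde\rho)$ is the set of all such inflations. A peg permutation $\tilde\tau$ is contained in $\tilde\rho$ if there is a subsequence $\tilde\rho_{i_1}\cdots\tilde\rho_{i_k}$ whose underlying entries have the same relative order as $\tau$ and such that for each $j$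 either $\tilde\rho_{i_j}$ and $\tilde\tau_j$ have the same decoration or $\tilde\tau_j$ is decorated $\bullet$. $\tilde\rho$ is compact if $\mathcal{I}(\tilde\tau)\ne\mathcal{I}(\tilde\rho)$ for every peg permutation $\tilde\tau\ne\tilde\rho$ contained in $\tilde\rho$. A permutation $\pi$ fills $\tilde\rho$ if $\pi=\tilde\rho(\vec v)$ with $v_i=1$ for every dotted entry and $v_i\ge2$ for every signed entry. An interval of a (peg) permutation is a set of positionally consecutive entries whose values are consecutive integers. -}

module Defs where

open import Data.Nat using (ℕ; zero; suc; _+_; _≤_; _<_; _<?_)
open import Data.Fin using (Fin; toℕ)
open import Data.List using (List; []; _∷_; map; filter; upTo; reverse; concatMap; allFin)
open import Data.Nat.ListAction using (sum)
open import Data.Product using (Σ; _×_; _,_; ∃)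
open import Data.Sum using (_⊎_)
open import Function.Definitions using (Injective)
open import Function.Bundles using (_⇔_)
open import Relation.Binary.PropositionalEquality using (_≡_; _≢_)
open import Relation.Nullary using (¬_)

data Deco : Set where
  plus minus dot : Deco

-- A peg permutation of length m: a permutation ρ of Fin m (given as an
-- injective map, position ↦ value, 0-based) together with a decoration
-- of each entry.
record Peg : Set where
  constructor peg
  field
    len  : ℕ
    ρ    : Fin len → Fin len
    ρ-inj : Injective _≡_ _≡_ ρ
    deco : Fin len → Deco
open Peg public

pegList : Peg → List (ℕ × Deco)
pegList p = map (λ i → toℕ (ρ p i) , deco p i) (allFin (len p))

Admissible : (p : Peg) → (Fin (len p) → ℕ) → Set
Admissible p v = ∀ i → deco p i ≡ dot → v i ≤ 1

-- Inflation ρ̃(v), as a list of values (0-based, already standardized):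
-- block i occupies the values [off i , off i + v i), where off i is the
-- total size of the blocks whose ρ-value is smaller than ρ i.
offset : (p : Peg) → (Fin (len p) → ℕ) → Fin (len p) → ℕ
offset p v i = sum (map v (filter (λ j → toℕ (ρ p j) <? toℕ (ρ p i)) (allFin (len p))))

block : (p : Peg) → (Fin (len p) → ℕ) → Fin (len p) → List ℕ
block p v i with deco p i
... | plus  = map (offset p v i +_) (upTo (v i))
... | minus = reverse (map (offset p v i +_) (upTo (v i)))
... | dot   = map (offset p v i +_) (upTo (v i))

inflate : (p : Peg) → (Fin (len p) → ℕ) → List ℕ
inflate p v = concatMap (block p v) (allFin (len p))

InI : Peg → List ℕ → Set
InI p π = Σ (Fin (len p) → ℕ) λ v → Admissible p v × inflate p v ≡ π

SameI : Peg → Peg → Set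
SameI p q = ∀ π → InI p π ⇔ InI q π

StrictlyIncreasing : {k m : ℕ} → (Fin k → Fin m) → Set
StrictlyIncreasing f = ∀ a b → toℕ a < toℕ b → toℕ (f a) < toℕ (f b)

Contained : Peg → Peg → Set
Contained t r =
  Σ (Fin (len t) → Fin (len r)) λ f →
    StrictlyIncreasing f
    × (∀ a b → (toℕ (ρ t a) < toℕ (ρ t b)) ⇔ (toℕ (ρ r (f a)) < toℕ (ρ r (f b))))
    × (∀ a → deco t a ≡ dot ⊎ deco t a ≡ deco r (f a))

Compact : Peg → Set
Compact r = ∀ t → Contained t r → pegList t ≢ pegList r → ¬ SameI t r

data IncPair : Deco → Deco → Set where
  pp : IncPair plus plus
  pd : IncPair plus dot
  dp : IncPair dot plus

data DecPair : Deco → Deco → Set where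
  mm : DecPair minus minus
  md : DecPair minus dot
  dm : DecPair dot minus

BadAdjacent : (p : Peg) → Fin (len p) → Fin (len p) → Set
BadAdjacent p i j =
    (toℕ (ρ p j) ≡ suc (toℕ (ρ p i)) × IncPair (deco p i) (deco p j))
  ⊎ (toℕ (ρ p i) ≡ suc (toℕ (ρ p j)) × DecPair (deco p i) (deco p j))

NoBadAdjacent : Peg → Set
NoBadAdjacent p = ∀ i j → toℕ j ≡ suc (toℕ i) → ¬ BadAdjacent p i j

FillingVector : (p : Peg) → (Fin (len p) → ℕ) → Set
FillingVector p v = ∀ i → (deco p i ≡ dot → v i ≡ 1) × (deco p i ≢ dot → 2 ≤ v i)

Fills : List ℕ → Peg → Set
Fills π p = Σ (Fin (len p) → ℕ) λ v → FillingVector p v × inflate p v ≡ π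

UniqueFillings : Peg → Set
UniqueFillings p = ∀ π → Fills π p →
  Σ (Fin (len p) → ℕ) λ v → Admissible p v × inflate p v ≡ π
    × (∀ w → Admissible p w → inflate p w ≡ π → ∀ i → w i ≡ v i)

-- Inflating entry i of ρ̃ by v i produces a block of consecutive values starting at
-- offset i = Σ {v j ∣ ρ j < ρ i}, read upwards or downwards according to the decoration.
-- At a forbidden adjacency the two blocks concatenate to a single monotone run, so mass can
-- be moved from one entry onto the signed one without changing ρ̃(v).  This contradicts
-- uniqueness of the vector of a filling (3 ⇒ 2), and, once an entry is emptied, shows that
-- deleting it does not change 𝓘(ρ̃) (1 ⇒ 2).  Conversely, let v be a filling vector and
-- ρ̃(w) = ρ̃(v).  If w ≠ v, some boundary between consecutive blocks of v lies strictly inside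
-- a block of w, so the last entry x of one v-block and the first entry y of the next are
-- adjacent in a monotone run of w; since v-blocks of signed entries have length ≥ 2, the
-- only way x, y can differ by one is that the two v-blocks form a forbidden adjacency (2 ⇒ 3).
-- Finally, if τ̃ ⊆ ρ̃ has the same inflations, writing the canonical filling of ρ̃ as an
-- inflation of τ̃ and using uniqueness shows that τ̃ uses every entry of ρ̃, so τ̃ = ρ̃ (2 ⇒ 1).
module Submission where

open import Defs
open import Data.Bool using (true; false; if_then_else_)
open import Data.Empty using (⊥; ⊥-elim)
open import Data.Fin using (Fin; toℕ; zero; suc; punchIn; punchOut; fromℕ<)
open import Data.Fin.Properties as Fin
  using ( toℕ-injective; toℕ<n; toℕ-fromℕ<; any?; pigeonhole; punchIn-injective; punchInᵢ≢i
        ; punchIn-mono-≤; punchOut-mono-≤; punchOut-cancel-≤; punchOut-injective; punchIn-punchOut)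
open import Data.List
  using ( List; []; _∷_; _++_; _∷ʳ_; foldr; map; filter; concat; tabulate; allFin; upTo; applyUpTo; reverse
        ; length; initLast; _∷ʳ′_)
open import Data.List.Properties
  using ( ++-assoc; ++-identityʳ; ∷-injective; ∷-injectiveˡ; ∷ʳ-injectiveʳ; tabulate-cong; map-tabulate
        ; map-upTo; unfold-reverse; reverse-++; reverse-involutive; length-reverse; length-++; length-map
        ; length-tabulate)
open import Data.List.Relation.Unary.All using (All; []; _∷_)
open import Data.List.Relation.Unary.All.Properties using (tabulate⁻)
open import Data.List.Relation.Unary.Linked as Linked using (Linked; []; [-]; _∷_)
open import Data.Nat using (ℕ; zero; suc; _+_; _≤_; _<_; z≤n; s≤s; s≤s⁻¹; s<s⁻¹; _<?_)
open import Data.Nat.ListAction using (sum)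
open import Data.Nat.Properties
open import Algebra.Properties.CommutativeSemigroup +-commutativeSemigroup using (interchange)
open import Data.Product using (Σ; ∃; ∃₂; _×_; _,_; proj₁; proj₂)
open import Data.Sum using (_⊎_; inj₁; inj₂)
open import Function using (_∘_; case_of_)
open import Function.Bundles using (_⇔_; mk⇔; Equivalence)
open import Function.Definitions using (Injective)
open import Function.Properties.Equivalence using () renaming (sym to ⇔-sym)
open import Relation.Binary.Definitions using (tri<; tri≈; tri>)
open import Relation.Binary.PropositionalEquality
open import Relation.Nullary using (¬_; yes; no; does)
open import Relation.Nullary.Decidable using (dec-true; dec-false; does-⇔)
open import Relation.Unary using (Decidable)


Next : ∀ {n} → Fin n → Fin n → Set
Next i j = toℕ j ≡ suc (toℕ i)

linked-tabulate : ∀ {n m} (g : Fin n → Fin m) → (∀ i j → Next i j → Next (g i) (g j)) →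
                  Linked Next (tabulate g)
linked-tabulate {zero}        g g-next = []
linked-tabulate {suc zero}    g g-next = [-]
linked-tabulate {suc (suc n)} g g-next =
  g-next zero (suc zero) refl ∷ linked-tabulate (g ∘ suc) (λ i j next → g-next (suc i) (suc j) (cong suc next))

strictlyIncreasing⇒injective : ∀ {k m} {f : Fin k → Fin m} → StrictlyIncreasing f → Injective _≡_ _≡_ f
strictlyIncreasing⇒injective {f = f} si {a} {b} fa≡fb with <-cmp (toℕ a) (toℕ b)
... | tri≈ _ a≡b _ = toℕ-injective a≡b
... | tri< a<b _ _ = ⊥-elim (<-irrefl (cong toℕ fa≡fb) (si a b a<b))
... | tri> _ _ b<a = ⊥-elim (<-irrefl (cong toℕ (sym fa≡fb)) (si b a b<a))

module _ {k m} (f : Fin k → Fin (suc m)) (0≢f : ∀ a → zero ≢ f a) where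

  lowerImage : Fin k → Fin m
  lowerImage a = punchOut (0≢f a)

  suc-lowerImage : ∀ a → suc (lowerImage a) ≡ f a
  suc-lowerImage a = punchIn-punchOut (0≢f a)

  lowerImage-strictlyIncreasing : StrictlyIncreasing f → StrictlyIncreasing lowerImage
  lowerImage-strictlyIncreasing si a b a<b =
    s<s⁻¹ (subst₂ (λ x y → toℕ x < toℕ y) (sym (suc-lowerImage a)) (sym (suc-lowerImage b)) (si a b a<b))

injective⇒surjective : ∀ {n} {σ : Fin n → Fin n} → Injective _≡_ _≡_ σ → ∀ y → ∃ λ x → σ x ≡ y
injective⇒surjective {suc n} {σ} σ-inj y with any? (λ x → σ x Fin.≟ y)
... | yes hit = hit
... | no miss with pigeonhole (n<1+n n) (λ x → punchOut (λ y≡σx → miss (x , sym y≡σx)))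
...   | i , j , i<j , eq = ⊥-elim (<-irrefl (cong toℕ (σ-inj (punchOut-injective
                             (λ y≡σi → miss (i , sym y≡σi)) (λ y≡σj → miss (j , sym y≡σj)) eq))) i<j)

strictlyIncreasing-spread : ∀ {k m} {f : Fin (suc k) → Fin m} → StrictlyIncreasing f →
                            ∀ a → toℕ (f zero) + toℕ a ≤ toℕ (f a)
strictlyIncreasing-spread {f = f} si zero    = ≤-reflexive (+-identityʳ (toℕ (f zero)))
strictlyIncreasing-spread {suc k} {f = f} si (suc a) = begin
  toℕ (f zero) + suc (toℕ a)    ≡⟨ +-suc (toℕ (f zero)) (toℕ a) ⟩
  suc (toℕ (f zero) + toℕ a)    ≤⟨ +-monoˡ-≤ (toℕ a) (si zero (suc zero) (s≤s z≤n)) ⟩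
  toℕ (f (suc zero)) + toℕ a    ≤⟨ strictlyIncreasing-spread (λ b c b<c → si (suc b) (suc c) (s≤s b<c)) a ⟩
  toℕ (f (suc a))               ∎
  where open ≤-Reasoning

strictlyIncreasing⇒toℕ-≤ : ∀ {k m} {f : Fin k → Fin m} → StrictlyIncreasing f → ∀ a → toℕ a ≤ toℕ (f a)
strictlyIncreasing⇒toℕ-≤ {suc k} {f = f} si a =
  ≤-trans (m≤n+m (toℕ a) (toℕ (f zero))) (strictlyIncreasing-spread si a)

module _ {k m} {f : Fin k → Fin m} (si : StrictlyIncreasing f) (onto : ∀ x → ∃ λ a → f a ≡ x) where

  private
    section : Fin m → Fin k
    section x = proj₁ (onto x)

    section-inverse : ∀ x → f (section x) ≡ x
    section-inverse x = proj₂ (onto x)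

    section-injective : Injective _≡_ _≡_ section
    section-injective {x} {y} eq = trans (sym (section-inverse x)) (trans (cong f eq) (section-inverse y))

    section-strictlyIncreasing : StrictlyIncreasing section
    section-strictlyIncreasing x y x<y with <-cmp (toℕ (section x)) (toℕ (section y))
    ... | tri< lt _ _ = lt
    ... | tri≈ _ eq _ = ⊥-elim (<-irrefl (cong toℕ (section-injective (toℕ-injective eq))) x<y)
    ... | tri> _ _ gt = ⊥-elim (<-asym x<y (subst₂ (λ a b → toℕ a < toℕ b)
                                                   (section-inverse y) (section-inverse x) (si _ _ gt)))

  strictlyIncreasing-onto⇒toℕ-preserving : ∀ a → toℕ (f a) ≡ toℕ a
  strictlyIncreasing-onto⇒toℕ-preserving a = ≤-antisym
    (subst (λ b → toℕ (f a) ≤ toℕ b) (strictlyIncreasing⇒injective si (section-inverse (f a)))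
           (strictlyIncreasing⇒toℕ-≤ section-strictlyIncreasing (f a)))
    (strictlyIncreasing⇒toℕ-≤ si a)

  strictlyIncreasing-onto⇒equal-size : k ≡ m
  strictlyIncreasing-onto⇒equal-size =
    Fin.cantor-schröder-bernstein (strictlyIncreasing⇒injective si) section-injective

punchOut-<-⇔ : ∀ {n} {c x y : Fin (suc n)} (c≢x : c ≢ x) (c≢y : c ≢ y) →
               (toℕ (punchOut c≢x) < toℕ (punchOut c≢y)) ⇔ (toℕ x < toℕ y)
punchOut-<-⇔ c≢x c≢y = mk⇔
  (λ px<py → ≰⇒> (λ y≤x → <⇒≱ px<py (punchOut-mono-≤ c≢y c≢x y≤x)))
  (λ x<y → ≰⇒> (λ py≤px → <⇒≱ x<y (punchOut-cancel-≤ c≢y c≢x py≤px)))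

punchIn-strictlyIncreasing : ∀ {n} (e : Fin (suc n)) → StrictlyIncreasing (punchIn e)
punchIn-strictlyIncreasing e a b a<b = ≤∧≢⇒< (punchIn-mono-≤ e a b (<⇒≤ a<b))
  (λ eq → <-irrefl (cong toℕ (punchIn-injective e a b (toℕ-injective eq))) a<b)

punchIn-misses-only : ∀ {n} (e : Fin (suc n)) {x} → (∀ a → punchIn e a ≢ x) → x ≡ e
punchIn-misses-only e {x} x∉ with x Fin.≟ e
... | yes x≡e = x≡e
... | no  x≢e = ⊥-elim (x∉ _ (punchIn-punchOut (x≢e ∘ sym)))

orderIsomorphic⇒toℕ-≡ : ∀ {k m} {σ : Fin k → Fin k} {τ : Fin k → Fin m} →
                        Injective _≡_ _≡_ σ → (∀ z → ∃ λ a → τ a ≡ z) →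
                        (∀ a b → (toℕ (σ a) < toℕ (σ b)) ⇔ (toℕ (τ a) < toℕ (τ b))) →
                        ∀ a → toℕ (τ a) ≡ toℕ (σ a)
orderIsomorphic⇒toℕ-≡ {k} {m} {σ} {τ} σ-inj τ-onto same-order a =
  trans (cong (toℕ ∘ τ) (sym (σ⁻¹∘σ a))) (strictlyIncreasing-onto⇒toℕ-preserving h-inc h-onto (σ a))
  where
  σ⁻¹ : Fin k → Fin k
  σ⁻¹ y = proj₁ (injective⇒surjective σ-inj y)
  σ∘σ⁻¹ : ∀ y → σ (σ⁻¹ y) ≡ y
  σ∘σ⁻¹ y = proj₂ (injective⇒surjective σ-inj y)
  σ⁻¹∘σ : ∀ a → σ⁻¹ (σ a) ≡ a
  σ⁻¹∘σ a = σ-inj (σ∘σ⁻¹ (σ a))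
  h : Fin k → Fin m
  h = τ ∘ σ⁻¹
  h-inc : StrictlyIncreasing h
  h-inc y z y<z = Equivalence.to (same-order (σ⁻¹ y) (σ⁻¹ z))
                    (subst₂ (λ y′ z′ → toℕ y′ < toℕ z′) (sym (σ∘σ⁻¹ y)) (sym (σ∘σ⁻¹ z)) y<z)
  h-onto : ∀ z → ∃ λ y → h y ≡ z
  h-onto z = σ (proj₁ (τ-onto z)) , trans (cong τ (σ⁻¹∘σ _)) (proj₂ (τ-onto z))

tabulate-cong-toℕ : ∀ {X : Set} {k m} (g : Fin k → X) (h : Fin m → X) → k ≡ m →
                    (∀ a b → toℕ a ≡ toℕ b → g a ≡ h b) → tabulate g ≡ tabulate h
tabulate-cong-toℕ {k = zero}  {zero}  g h _   _     = refl
tabulate-cong-toℕ {k = suc k} {suc m} g h k≡m g≈h =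
  cong₂ _∷_ (g≈h zero zero refl)
            (tabulate-cong-toℕ (g ∘ suc) (h ∘ suc) (suc-injective k≡m)
                               (λ a b eq → g≈h (suc a) (suc b) (cong suc eq)))


module FinFold {A : Set} (_∙_ : A → A → A) (ε : A)
               (∙-assoc : ∀ x y z → (x ∙ y) ∙ z ≡ x ∙ (y ∙ z))
               (∙-identityˡ : ∀ x → ε ∙ x ≡ x) where

  ⨁ : ∀ {n} → (Fin n → A) → A
  ⨁ f = foldr _∙_ ε (tabulate f)

  ⨁-cong : ∀ {n} {f g : Fin n → A} → (∀ x → f x ≡ g x) → ⨁ f ≡ ⨁ g
  ⨁-cong f≗g = cong (foldr _∙_ ε) (tabulate-cong f≗g)

  ⨁-ε : ∀ {n} (f : Fin n → A) → (∀ x → f x ≡ ε) → ⨁ f ≡ ε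
  ⨁-ε {zero}  f f≗ε = refl
  ⨁-ε {suc n} f f≗ε = trans (cong₂ _∙_ (f≗ε zero) (⨁-ε (f ∘ suc) (f≗ε ∘ suc))) (∙-identityˡ ε)

  ⨁-adjacent : ∀ {n} (i j : Fin n) → Next i j → (f g : Fin n → A) →
               (∀ k → k ≢ i → k ≢ j → f k ≡ g k) → f i ∙ f j ≡ g i ∙ g j → ⨁ f ≡ ⨁ g
  ⨁-adjacent {suc (suc n)} zero (suc zero) refl f g agree fi∙fj≡gi∙gj = begin
    f zero ∙ (f (suc zero) ∙ rest f)   ≡⟨ ∙-assoc (f zero) (f (suc zero)) (rest f) ⟨
    (f zero ∙ f (suc zero)) ∙ rest f   ≡⟨ cong₂ _∙_ fi∙fj≡gi∙gj (⨁-cong rest-agrees) ⟩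
    (g zero ∙ g (suc zero)) ∙ rest g   ≡⟨ ∙-assoc (g zero) (g (suc zero)) (rest g) ⟩
    g zero ∙ (g (suc zero) ∙ rest g)   ∎
    where
    open ≡-Reasoning
    rest : (Fin (suc (suc n)) → A) → A
    rest h = ⨁ (λ x → h (suc (suc x)))
    rest-agrees : ∀ x → f (suc (suc x)) ≡ g (suc (suc x))
    rest-agrees x = agree (suc (suc x)) (λ ()) (λ ())
  ⨁-adjacent {suc n} (suc i) (suc j) j≡1+i f g agree fi∙fj≡gi∙gj =
    cong₂ _∙_ (agree zero (λ ()) (λ ()))
      (⨁-adjacent i j (suc-injective j≡1+i) (f ∘ suc) (g ∘ suc)
        (λ k k≢i k≢j → agree (suc k) (k≢i ∘ Fin.suc-injective) (k≢j ∘ Fin.suc-injective)) fi∙fj≡gi∙gj)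

  ⨁-restrict : ∀ {k m} (f : Fin k → Fin m) → StrictlyIncreasing f → (B : Fin m → A) →
               (∀ x → (∀ a → f a ≢ x) → B x ≡ ε) → ⨁ B ≡ ⨁ (B ∘ f)
  ⨁-restrict {zero}  {zero}  f si B outside = refl
  ⨁-restrict {suc k} {zero}  f si B outside with f zero
  ... | ()
  ⨁-restrict {zero}  {suc m} f si B outside = ⨁-ε B (λ x → outside x (λ ()))
  ⨁-restrict {suc k} {suc m} f si B outside with f zero Fin.≟ zero
  ... | yes f0≡0 = cong₂ _∙_ (cong B (sym f0≡0)) (begin
      ⨁ (B ∘ suc)        ≡⟨ ⨁-restrict f′ f′-inc (B ∘ suc) outside′ ⟩
      ⨁ (B ∘ suc ∘ f′)   ≡⟨ ⨁-cong (cong B ∘ suc-lowerImage (f ∘ suc) 0≢f′) ⟩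
      ⨁ (B ∘ f ∘ suc)    ∎)
    where
    open ≡-Reasoning
    0≢f′ : ∀ a → zero ≢ f (suc a)
    0≢f′ a 0≡fa = <-irrefl (cong toℕ (trans f0≡0 0≡fa)) (si zero (suc a) (s≤s z≤n))
    f′ : Fin k → Fin m
    f′ = lowerImage (f ∘ suc) 0≢f′
    f′-inc : StrictlyIncreasing f′
    f′-inc = lowerImage-strictlyIncreasing (f ∘ suc) 0≢f′ (λ a b → si (suc a) (suc b) ∘ s≤s)
    outside′ : ∀ x → (∀ a → f′ a ≢ x) → B (suc x) ≡ ε
    outside′ x x∉f′ = outside (suc x) λ
      { zero    f0≡x → Fin.0≢1+n (trans (sym f0≡0) f0≡x)
      ; (suc a) fa≡x → x∉f′ a (Fin.suc-injective (trans (suc-lowerImage (f ∘ suc) 0≢f′ a) fa≡x)) }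
  ... | no f0≢0 = begin
      B zero ∙ ⨁ (B ∘ suc)   ≡⟨ cong (_∙ ⨁ (B ∘ suc)) (outside zero (λ a → 0≢f a ∘ sym)) ⟩
      ε ∙ ⨁ (B ∘ suc)        ≡⟨ ∙-identityˡ _ ⟩
      ⨁ (B ∘ suc)            ≡⟨ ⨁-restrict f′ (lowerImage-strictlyIncreasing f 0≢f si) (B ∘ suc) outside′ ⟩
      ⨁ (B ∘ suc ∘ f′)       ≡⟨ ⨁-cong (cong B ∘ suc-lowerImage f 0≢f) ⟩
      ⨁ (B ∘ f)              ∎
    where
    open ≡-Reasoning
    0≢f : ∀ a → zero ≢ f a
    0≢f zero    0≡f0 = f0≢0 (sym 0≡f0)
    0≢f (suc a) 0≡fa = n≮0 (subst (λ x → toℕ (f zero) < toℕ x) (sym 0≡fa) (si zero (suc a) (s≤s z≤n)))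
    f′ : Fin (suc k) → Fin m
    f′ = lowerImage f 0≢f
    outside′ : ∀ x → (∀ a → f′ a ≢ x) → B (suc x) ≡ ε
    outside′ x x∉f′ = outside (suc x) λ a fa≡x →
      x∉f′ a (Fin.suc-injective (trans (suc-lowerImage f 0≢f a) fa≡x))

module Sum = FinFold _+_ 0 +-assoc +-identityˡ
open Sum using () renaming (⨁ to ∑)

∑-+ : ∀ {n} (f g : Fin n → ℕ) → ∑ (λ x → f x + g x) ≡ ∑ f + ∑ g
∑-+ {zero}  f g = refl
∑-+ {suc n} f g = trans (cong (f zero + g zero +_) (∑-+ (f ∘ suc) (g ∘ suc)))
                        (interchange (f zero) (g zero) (∑ (f ∘ suc)) (∑ (g ∘ suc)))

∑-mono-≤ : ∀ {n} {f g : Fin n → ℕ} → (∀ x → f x ≤ g x) → ∑ f ≤ ∑ g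
∑-mono-≤ {zero}  f≤g = z≤n
∑-mono-≤ {suc n} f≤g = +-mono-≤ (f≤g zero) (∑-mono-≤ (f≤g ∘ suc))

indicator : ∀ {n} → Fin n → (Fin n → ℕ) → Fin n → ℕ
indicator i v x = if does (x Fin.≟ i) then v x else 0

∑-indicator : ∀ {n} (i : Fin n) (v : Fin n → ℕ) → ∑ (indicator i v) ≡ v i
∑-indicator {suc n} zero    v = trans (cong (v zero +_) (Sum.⨁-ε {n} _ (λ _ → refl))) (+-identityʳ (v zero))
∑-indicator {suc n} (suc i) v = trans (Sum.⨁-cong shift) (∑-indicator i (v ∘ suc))
  where
  shift : ∀ x → indicator (suc i) v (suc x) ≡ indicator i (v ∘ suc) x
  shift x with x Fin.≟ i
  ... | yes _ = refl
  ... | no  _ = refl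

sum-map-filter : ∀ {A : Set} {P : A → Set} (P? : Decidable P) (v : A → ℕ) xs →
                 sum (map v (filter P? xs)) ≡ sum (map (λ x → if does (P? x) then v x else 0) xs)
sum-map-filter P? v [] = refl
sum-map-filter P? v (x ∷ xs) with does (P? x)
... | true  = cong (v x +_) (sum-map-filter P? v xs)
... | false = sum-map-filter P? v xs


val : (p : Peg) → Fin (len p) → ℕ
val p x = toℕ (ρ p x)

val-injective : (p : Peg) → ∀ {x y} → val p x ≡ val p y → x ≡ y
val-injective p = ρ-inj p ∘ toℕ-injective

share : (p : Peg) → (Fin (len p) → ℕ) → Fin (len p) → Fin (len p) → ℕ
share p v i x = if does (val p x <? val p i) then v x else 0

share-cong : (p : Peg) {v w : Fin (len p) → ℕ} {i x : Fin (len p)} → v x ≡ w x → share p v i x ≡ share p w i x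
share-cong p {i = i} {x} = cong (λ n → if does (val p x <? val p i) then n else 0)

offset≡∑share : (p : Peg) (v : Fin (len p) → ℕ) (i : Fin (len p)) → offset p v i ≡ ∑ (share p v i)
offset≡∑share p v i = trans (sum-map-filter (λ j → val p j <? val p i) v (allFin (len p)))
                            (cong sum (map-tabulate (λ x → x) (share p v i)))

module _ (p : Peg) (v : Fin (len p) → ℕ) where

  share-< : ∀ {i x} → val p x < val p i → share p v i x ≡ v x
  share-< {i} {x} x<i = cong (if_then v x else 0) (dec-true (val p x <? val p i) x<i)

  share-≮ : ∀ {i x} → ¬ val p x < val p i → share p v i x ≡ 0
  share-≮ {i} {x} x≮i = cong (if_then v x else 0) (dec-false (val p x <? val p i) x≮i)

  share-0 : ∀ {i x} → v x ≡ 0 → share p v i x ≡ 0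
  share-0 {i} {x} vx≡0 with does (val p x <? val p i)
  ... | true  = vx≡0
  ... | false = refl

  offset-< : ∀ {i j} → val p i < val p j → offset p v i + v i ≤ offset p v j
  offset-< {i} {j} i<j = begin
    offset p v i + v i                          ≡⟨ cong₂ _+_ (offset≡∑share p v i) (sym (∑-indicator i v)) ⟩
    ∑ (share p v i) + ∑ (indicator i v)         ≡⟨ ∑-+ (share p v i) (indicator i v) ⟨
    ∑ (λ x → share p v i x + indicator i v x)   ≤⟨ ∑-mono-≤ pointwise ⟩
    ∑ (share p v j)                             ≡⟨ offset≡∑share p v j ⟨
    offset p v j                                ∎
    where
    open ≤-Reasoning
    pointwise : ∀ x → share p v i x + indicator i v x ≤ share p v j x
    pointwise x with x Fin.≟ i | val p x <? val p i
    ... | yes refl | _      = ≤-reflexive (trans (cong (_+ v x) (share-≮ (<-irrefl refl))) (sym (share-< i<j)))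
    ... | no x≢i | yes x<i = ≤-reflexive (trans (cong (_+ 0) (share-< x<i))
                                               (trans (+-identityʳ (v x)) (sym (share-< (<-trans x<i i<j)))))
    ... | no x≢i | no x≮i  = ≤-trans (≤-reflexive (cong (_+ 0) (share-≮ x≮i))) z≤n

  offset-suc : ∀ {i j} → val p j ≡ suc (val p i) → offset p v j ≡ offset p v i + v i
  offset-suc {i} {j} j≡1+i = begin
    offset p v j                                ≡⟨ offset≡∑share p v j ⟩
    ∑ (share p v j)                             ≡⟨ Sum.⨁-cong pointwise ⟩
    ∑ (λ x → share p v i x + indicator i v x)   ≡⟨ ∑-+ (share p v i) (indicator i v) ⟩
    ∑ (share p v i) + ∑ (indicator i v)         ≡⟨ cong₂ _+_ (offset≡∑share p v i) (sym (∑-indicator i v)) ⟨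
    offset p v i + v i                          ∎
    where
    open ≡-Reasoning
    i<j : val p i < val p j
    i<j = ≤-reflexive (sym j≡1+i)
    pointwise : ∀ x → share p v j x ≡ share p v i x + indicator i v x
    pointwise x with x Fin.≟ i | val p x <? val p i
    ... | yes refl | _      = trans (share-< i<j) (cong (_+ v x) (sym (share-≮ (<-irrefl refl))))
    ... | no x≢i | yes x<i = trans (share-< (<-trans x<i i<j))
                                   (sym (trans (cong (_+ 0) (share-< x<i)) (+-identityʳ (v x))))
    ... | no x≢i | no x≮i  = trans (share-≮ x≮j) (sym (cong (_+ 0) (share-≮ x≮i)))
      where
      x≮j : ¬ val p x < val p j
      x≮j x<j = x≮i (≤∧≢⇒< (s≤s⁻¹ (subst (val p x <_) j≡1+i x<j)) (x≢i ∘ val-injective p))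

module _ (p : Peg) where

  consecutive-compare-alike : ∀ {i j k} → val p j ≡ suc (val p i) → k ≢ j →
                              (val p i < val p k) ⇔ (val p j < val p k)
  consecutive-compare-alike {i} {j} {k} j≡1+i k≢j = mk⇔
    (λ i<k → subst (_< val p k) (sym j≡1+i) (≤∧≢⇒< i<k 1+i≢k))
    (λ j<k → <-trans (subst (val p i <_) (sym j≡1+i) (n<1+n (val p i))) j<k)
    where
    1+i≢k : suc (val p i) ≢ val p k
    1+i≢k 1+i≡k = k≢j (val-injective p (trans (sym 1+i≡k) (sym j≡1+i)))

  offset-transfer : ∀ {i j} → Next i j → (v w : Fin (len p) → ℕ) →
                    (∀ k → k ≢ i → k ≢ j → v k ≡ w k) → v i + v j ≡ w i + w j →
                    ∀ k → (val p i < val p k ⇔ val p j < val p k) → offset p v k ≡ offset p w k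
  offset-transfer {i} {j} adjacent v w agree sum-ij k alike = begin
    offset p v k      ≡⟨ offset≡∑share p v k ⟩
    ∑ (share p v k)   ≡⟨ Sum.⨁-adjacent i j adjacent (share p v k) (share p w k)
                           (λ x x≢i x≢j → share-cong p {v} {w} (agree x x≢i x≢j)) pair ⟩
    ∑ (share p w k)   ≡⟨ offset≡∑share p w k ⟨
    offset p w k      ∎
    where
    open ≡-Reasoning
    pair : share p v k i + share p v k j ≡ share p w k i + share p w k j
    pair with does (val p i <? val p k) | does (val p j <? val p k)
            | does-⇔ alike (val p i <? val p k) (val p j <? val p k)
    ... | true  | .true  | refl = sum-ij
    ... | false | .false | refl = refl

val-onto : (p : Peg) → ∀ k → k < len p → ∃ λ c → val p c ≡ k
val-onto p k k<len with injective⇒surjective (ρ-inj p) (fromℕ< k<len)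
... | c , ρc≡k = c , trans (cong toℕ ρc≡k) (toℕ-fromℕ< k<len)

offset-gap : (p : Peg) (v : Fin (len p) → ℕ) → (∀ i → 1 ≤ v i) → ∀ {a b} →
             val p a < val p b → offset p v b ≡ offset p v a + v a → val p b ≡ suc (val p a)
offset-gap p v positive {a} {b} a<b adjacent-offsets with <-cmp (suc (val p a)) (val p b)
... | tri≈ _ eq _ = sym eq
... | tri> _ _ b<1+a = ⊥-elim (<⇒≱ a<b (s≤s⁻¹ b<1+a))
... | tri< 1+a<b _ _ with val-onto p (suc (val p a)) (<-trans 1+a<b (toℕ<n (ρ p b)))
...   | c , c≡1+a =
  ⊥-elim (n≮0 (≤-trans (positive c) (+-cancelˡ-≤ (offset p v c) (v c) 0 c-squeezed)))
  where
  c-squeezed : offset p v c + v c ≤ offset p v c + 0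
  c-squeezed = begin
    offset p v c + v c   ≤⟨ offset-< p v (subst (_< val p b) (sym c≡1+a) 1+a<b) ⟩
    offset p v b         ≡⟨ adjacent-offsets ⟩
    offset p v a + v a   ≤⟨ offset-< p v (subst (val p a <_) (sym c≡1+a) (n<1+n (val p a))) ⟩
    offset p v c         ≡⟨ +-identityʳ (offset p v c) ⟨
    offset p v c + 0     ∎
    where open ≤-Reasoning


-- Blocks as monotone runs

module Concat = FinFold {List ℕ} _++_ [] ++-assoc (λ _ → refl)

AdmissibleSize : Deco → ℕ → Set
AdmissibleSize d n = d ≡ dot → n ≤ 1

ascending : ℕ → ℕ → List ℕ
ascending o zero    = []
ascending o (suc n) = o ∷ ascending (suc o) n

applyUpTo≡ascending : ∀ {f : ℕ → ℕ} o n → (∀ k → f k ≡ o + k) → applyUpTo f n ≡ ascending o n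
applyUpTo≡ascending o zero    f≗o+ = refl
applyUpTo≡ascending o (suc n) f≗o+ =
  cong₂ _∷_ (trans (f≗o+ 0) (+-identityʳ o))
            (applyUpTo≡ascending (suc o) n (λ k → trans (f≗o+ (suc k)) (+-suc o k)))

map-+-upTo : ∀ o n → map (o +_) (upTo n) ≡ ascending o n
map-+-upTo o n = trans (map-upTo (o +_) n) (applyUpTo≡ascending o n (λ _ → refl))

length-ascending : ∀ o n → length (ascending o n) ≡ n
length-ascending o zero    = refl
length-ascending o (suc n) = cong suc (length-ascending (suc o) n)

ascending-++ : ∀ o a b → ascending o a ++ ascending (o + a) b ≡ ascending o (a + b)
ascending-++ o zero    b = cong (λ o′ → ascending o′ b) (+-identityʳ o)
ascending-++ o (suc a) b = cong (o ∷_) (trans (cong (λ o′ → ascending (suc o) a ++ ascending o′ b) (+-suc o a))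
                                              (ascending-++ (suc o) a b))

run : Deco → ℕ → ℕ → List ℕ
run plus  o n = ascending o n
run minus o n = reverse (ascending o n)
run dot   o n = ascending o n

block≡run : (p : Peg) (v : Fin (len p) → ℕ) (i : Fin (len p)) →
            block p v i ≡ run (deco p i) (offset p v i) (v i)
block≡run p v i with deco p i
... | plus  = map-+-upTo (offset p v i) (v i)
... | minus = cong reverse (map-+-upTo (offset p v i) (v i))
... | dot   = map-+-upTo (offset p v i) (v i)

inflate≡⨁block : (p : Peg) (v : Fin (len p) → ℕ) → inflate p v ≡ Concat.⨁ (block p v)
inflate≡⨁block p v = cong concat (map-tabulate (λ x → x) (block p v))

length-run : ∀ d o n → length (run d o n) ≡ n
length-run plus  o n = length-ascending o n
length-run minus o n = trans (length-reverse (ascending o n)) (length-ascending o n)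
length-run dot   o n = length-ascending o n

length-block : (p : Peg) (v : Fin (len p) → ℕ) (i : Fin (len p)) → length (block p v i) ≡ v i
length-block p v i = trans (cong length (block≡run p v i)) (length-run (deco p i) (offset p v i) (v i))

data Ascending : Deco → Set where
  up-plus : Ascending plus
  up-dot  : Ascending dot

data Descending : Deco → Set where
  down-minus : Descending minus
  down-dot   : Descending dot

run-ascending : ∀ {d} o n → Ascending d → run d o n ≡ ascending o n
run-ascending o n up-plus = refl
run-ascending o n up-dot  = refl

run-descending : ∀ {d} o n → Descending d → AdmissibleSize d n → run d o n ≡ reverse (ascending o n)
run-descending o n             down-minus _ = refl
run-descending o zero          down-dot   _ = refl
run-descending o (suc zero)    down-dot   _ = refl
run-descending o (suc (suc n)) down-dot   n≤1 with n≤1 refl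
... | s≤s ()

incPair-ascending : ∀ {a b} → IncPair a b → Ascending a × Ascending b
incPair-ascending pp = up-plus , up-plus
incPair-ascending pd = up-plus , up-dot
incPair-ascending dp = up-dot  , up-plus

decPair-descending : ∀ {a b} → DecPair a b → Descending a × Descending b
decPair-descending mm = down-minus , down-minus
decPair-descending md = down-minus , down-dot
decPair-descending dm = down-dot   , down-minus

module _ (p : Peg) (v : Fin (len p) → ℕ) {i j : Fin (len p)} where

  private
    oᵢ oⱼ : ℕ
    oᵢ = offset p v i
    oⱼ = offset p v j

    as-runs : block p v i ++ block p v j ≡ run (deco p i) oᵢ (v i) ++ run (deco p j) oⱼ (v j)
    as-runs = cong₂ _++_ (block≡run p v i) (block≡run p v j)

  incPair-blocks : val p j ≡ suc (val p i) → IncPair (deco p i) (deco p j) →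
                   block p v i ++ block p v j ≡ ascending oᵢ (v i + v j)
  incPair-blocks j≡1+i inc = begin
    block p v i ++ block p v j
      ≡⟨ as-runs ⟩
    run (deco p i) oᵢ (v i) ++ run (deco p j) oⱼ (v j)
      ≡⟨ cong₂ _++_ (run-ascending oᵢ (v i) ascending-i) (run-ascending oⱼ (v j) ascending-j) ⟩
    ascending oᵢ (v i) ++ ascending oⱼ (v j)
      ≡⟨ cong (λ o → ascending oᵢ (v i) ++ ascending o (v j)) (offset-suc p v j≡1+i) ⟩
    ascending oᵢ (v i) ++ ascending (oᵢ + v i) (v j)
      ≡⟨ ascending-++ oᵢ (v i) (v j) ⟩
    ascending oᵢ (v i + v j) ∎
    where
    open ≡-Reasoning
    ascending-i : Ascending (deco p i)
    ascending-i = proj₁ (incPair-ascending inc)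
    ascending-j : Ascending (deco p j)
    ascending-j = proj₂ (incPair-ascending inc)

  decPair-blocks : val p i ≡ suc (val p j) → DecPair (deco p i) (deco p j) → Admissible p v →
                   block p v i ++ block p v j ≡ reverse (ascending oⱼ (v j + v i))
  decPair-blocks i≡1+j dec adm = begin
    block p v i ++ block p v j
      ≡⟨ as-runs ⟩
    run (deco p i) oᵢ (v i) ++ run (deco p j) oⱼ (v j)
      ≡⟨ cong₂ _++_ (run-descending oᵢ (v i) descending-i (adm i)) (run-descending oⱼ (v j) descending-j (adm j)) ⟩
    reverse (ascending oᵢ (v i)) ++ reverse (ascending oⱼ (v j))
      ≡⟨ cong (λ o → reverse (ascending o (v i)) ++ reverse (ascending oⱼ (v j))) (offset-suc p v i≡1+j) ⟩
    reverse (ascending (oⱼ + v j) (v i)) ++ reverse (ascending oⱼ (v j))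
      ≡⟨ reverse-++ (ascending oⱼ (v j)) (ascending (oⱼ + v j) (v i)) ⟨
    reverse (ascending oⱼ (v j) ++ ascending (oⱼ + v j) (v i))
      ≡⟨ cong reverse (ascending-++ oⱼ (v j) (v i)) ⟩
    reverse (ascending oⱼ (v j + v i)) ∎
    where
    open ≡-Reasoning
    descending-i : Descending (deco p i)
    descending-i = proj₁ (decPair-descending dec)
    descending-j : Descending (deco p j)
    descending-j = proj₂ (decPair-descending dec)

inflate-merge : (p : Peg) {i j : Fin (len p)} → Next i j → BadAdjacent p i j →
                (v w : Fin (len p) → ℕ) → Admissible p v → Admissible p w →
                (∀ k → k ≢ i → k ≢ j → v k ≡ w k) → v i + v j ≡ w i + w j →
                inflate p v ≡ inflate p w
inflate-merge p {i} {j} adjacent bad v w adm-v adm-w agree sum-ij = begin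
  inflate p v            ≡⟨ inflate≡⨁block p v ⟩
  Concat.⨁ (block p v)   ≡⟨ Concat.⨁-adjacent i j adjacent (block p v) (block p w) other (pair bad) ⟩
  Concat.⨁ (block p w)   ≡⟨ inflate≡⨁block p w ⟨
  inflate p w            ∎
  where
  open ≡-Reasoning
  i≢j : i ≢ j
  i≢j i≡j = 1+n≢n (sym (trans (cong toℕ i≡j) adjacent))
  offsets-agree : ∀ k → (val p i < val p k ⇔ val p j < val p k) → offset p v k ≡ offset p w k
  offsets-agree = offset-transfer p adjacent v w agree sum-ij
  other : ∀ k → k ≢ i → k ≢ j → block p v k ≡ block p w k
  other k k≢i k≢j = begin
    block p v k                                ≡⟨ block≡run p v k ⟩
    run (deco p k) (offset p v k) (v k)        ≡⟨ cong₂ (run (deco p k)) (offsets-agree k (alike bad))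
                                                             (agree k k≢i k≢j) ⟩
    run (deco p k) (offset p w k) (w k)        ≡⟨ block≡run p w k ⟨
    block p w k                                ∎
    where
    alike : BadAdjacent p i j → (val p i < val p k ⇔ val p j < val p k)
    alike (inj₁ (j≡1+i , _)) = consecutive-compare-alike p j≡1+i k≢j
    alike (inj₂ (i≡1+j , _)) = ⇔-sym (consecutive-compare-alike p i≡1+j k≢i)
  pair : BadAdjacent p i j → block p v i ++ block p v j ≡ block p w i ++ block p w j
  pair (inj₁ (j≡1+i , inc)) = begin
    block p v i ++ block p v j              ≡⟨ incPair-blocks p v j≡1+i inc ⟩
    ascending (offset p v i) (v i + v j)    ≡⟨ cong₂ ascending offset-i sum-ij ⟩
    ascending (offset p w i) (w i + w j)    ≡⟨ incPair-blocks p w j≡1+i inc ⟨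
    block p w i ++ block p w j              ∎
    where
    offset-i : offset p v i ≡ offset p w i
    offset-i = offsets-agree i (consecutive-compare-alike p j≡1+i i≢j)
  pair (inj₂ (i≡1+j , dec)) = begin
    block p v i ++ block p v j                        ≡⟨ decPair-blocks p v i≡1+j dec adm-v ⟩
    reverse (ascending (offset p v j) (v j + v i))    ≡⟨ cong₂ (λ o n → reverse (ascending o n)) offset-j sum-ji ⟩
    reverse (ascending (offset p w j) (w j + w i))    ≡⟨ decPair-blocks p w i≡1+j dec adm-w ⟨
    block p w i ++ block p w j                        ∎
    where
    offset-j : offset p v j ≡ offset p w j
    offset-j = offsets-agree j (⇔-sym (consecutive-compare-alike p i≡1+j (i≢j ∘ sym)))
    sum-ji : v j + v i ≡ w j + w i
    sum-ji = trans (+-comm (v j) (v i)) (trans sum-ij (+-comm (w i) (w j)))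


-- Restriction to a contained peg permutation

run-dot : ∀ {o n} → AdmissibleSize dot n → ∀ d → run dot o n ≡ run d o n
run-dot adm plus  = refl
run-dot adm minus = run-descending _ _ down-dot adm
run-dot adm dot   = refl

run-zero : ∀ d {o} → run d o 0 ≡ []
run-zero plus  = refl
run-zero minus = refl
run-zero dot   = refl

DecoCompatible : (t p : Peg) → (Fin (len t) → Fin (len p)) → Set
DecoCompatible t p f = ∀ a → deco t a ≡ dot ⊎ deco t a ≡ deco p (f a)

module Restrict (t p : Peg) (f : Fin (len t) → Fin (len p)) (f-inc : StrictlyIncreasing f)
                (f-ord : ∀ a b → (val t a < val t b) ⇔ (val p (f a) < val p (f b)))
                (u : Fin (len t) → ℕ) (u′ : Fin (len p) → ℕ)
                (u′∘f : ∀ a → u′ (f a) ≡ u a)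
                (u′-outside : ∀ x → (∀ a → f a ≢ x) → u′ x ≡ 0) where

  offset-restrict : ∀ a → offset p u′ (f a) ≡ offset t u a
  offset-restrict a = begin
    offset p u′ (f a)          ≡⟨ offset≡∑share p u′ (f a) ⟩
    ∑ (share p u′ (f a))       ≡⟨ Sum.⨁-restrict f f-inc (share p u′ (f a)) outside ⟩
    ∑ (share p u′ (f a) ∘ f)   ≡⟨ Sum.⨁-cong same-share ⟨
    ∑ (share t u a)            ≡⟨ offset≡∑share t u a ⟨
    offset t u a               ∎
    where
    open ≡-Reasoning
    outside : ∀ x → (∀ b → f b ≢ x) → share p u′ (f a) x ≡ 0
    outside x x∉f = share-0 p u′ (u′-outside x x∉f)
    same-share : ∀ b → share t u a b ≡ share p u′ (f a) (f b)
    same-share b = cong₂ (λ c n → if c then n else 0)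
                         (does-⇔ (f-ord b a) (val t b <? val t a) (val p (f b) <? val p (f a))) (sym (u′∘f b))

  inflate-restrict : Admissible t u → DecoCompatible t p f → inflate p u′ ≡ inflate t u
  inflate-restrict adm deco-ok = begin
    inflate p u′                  ≡⟨ inflate≡⨁block p u′ ⟩
    Concat.⨁ (block p u′)         ≡⟨ Concat.⨁-restrict f f-inc (block p u′) empty-outside ⟩
    Concat.⨁ (block p u′ ∘ f)     ≡⟨ Concat.⨁-cong same-block ⟩
    Concat.⨁ (block t u)          ≡⟨ inflate≡⨁block t u ⟨
    inflate t u                   ∎
    where
    open ≡-Reasoning
    empty-outside : ∀ x → (∀ a → f a ≢ x) → block p u′ x ≡ []
    empty-outside x x∉f =
      trans (block≡run p u′ x)
            (trans (cong (run (deco p x) (offset p u′ x)) (u′-outside x x∉f)) (run-zero (deco p x)))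
    same-block : ∀ a → block p u′ (f a) ≡ block t u a
    same-block a = begin
      block p u′ (f a)                                   ≡⟨ block≡run p u′ (f a) ⟩
      run (deco p (f a)) (offset p u′ (f a)) (u′ (f a))
        ≡⟨ cong₂ (run (deco p (f a))) (offset-restrict a) (u′∘f a) ⟩
      run (deco p (f a)) (offset t u a) (u a)            ≡⟨ same-run (deco-ok a) ⟨
      run (deco t a) (offset t u a) (u a)                ≡⟨ block≡run t u a ⟨
      block t u a                                        ∎
      where
      same-run : deco t a ≡ dot ⊎ deco t a ≡ deco p (f a) →
                 ∀ {o} → run (deco t a) o (u a) ≡ run (deco p (f a)) o (u a)
      same-run (inj₁ dot-a) = trans (cong (λ d → run d _ (u a)) dot-a) (run-dot (λ _ → adm a dot-a) (deco p (f a)))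
      same-run (inj₂ same)  = cong (λ d → run d _ (u a)) same

module _ {k m} (f : Fin k → Fin m) (u : Fin k → ℕ) where

  extend : Fin m → ℕ
  extend x with any? (λ a → f a Fin.≟ x)
  ... | yes (a , _) = u a
  ... | no _        = 0

  extend-∘ : Injective _≡_ _≡_ f → ∀ a → extend (f a) ≡ u a
  extend-∘ f-inj a with any? (λ b → f b Fin.≟ f a)
  ... | yes (b , fb≡fa) = cong u (f-inj fb≡fa)
  ... | no  miss        = ⊥-elim (miss (a , refl))

  extend-outside : ∀ x → (∀ a → f a ≢ x) → extend x ≡ 0
  extend-outside x x∉f with any? (λ a → f a Fin.≟ x)
  ... | yes (a , fa≡x) = ⊥-elim (x∉f a fa≡x)
  ... | no  _          = refl

  extend-hit : ∀ x → 1 ≤ extend x → ∃ λ a → f a ≡ x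
  extend-hit x pos with any? (λ a → f a Fin.≟ x)
  ... | yes hit = hit
  ... | no  _   = case pos of λ ()

extend-admissible : (t p : Peg) {f : Fin (len t) → Fin (len p)} → DecoCompatible t p f →
                    ∀ {u} → Admissible t u → Admissible p (extend f u)
extend-admissible t p {f} compatible {u} adm x dot-x with any? (λ a → f a Fin.≟ x)
... | no _ = z≤n
... | yes (a , refl) with compatible a
...   | inj₁ dot-a  = adm a dot-a
...   | inj₂ same-a = adm a (trans same-a dot-x)

contained⇒inflations-⊆ : ∀ {t p} → Contained t p → ∀ π → InI t π → InI p π
contained⇒inflations-⊆ {t} {p} (f , f-inc , f-ord , compatible) π (u , adm , u↦π) =
  extend f u , extend-admissible t p compatible adm ,
  trans (Restrict.inflate-restrict t p f f-inc f-ord u (extend f u)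
           (extend-∘ f u (strictlyIncreasing⇒injective f-inc)) (extend-outside f u) adm compatible) u↦π


-- Two segmentations of one list

module _ {X : Set} where

  Consecutive : X → X → List X → Set
  Consecutive x y L = ∃₂ λ P Q → L ≡ P ++ x ∷ y ∷ Q

  ++-split : ∀ (P Q U V : List X) → P ++ Q ≡ U ++ V →
             (∃ λ M → U ≡ P ++ M × Q ≡ M ++ V) ⊎ (∃ λ M → P ≡ U ++ M × V ≡ M ++ Q)
  ++-split []      Q U       V eq = inj₁ (U , refl , eq)
  ++-split (p ∷ P) Q []      V eq = inj₂ (p ∷ P , refl , sym eq)
  ++-split (p ∷ P) Q (u ∷ U) V eq with ∷-injective eq
  ... | refl , eq′ with ++-split P Q U V eq′
  ...   | inj₁ (M , U≡P++M , Q≡M++V) = inj₁ (M , cong (p ∷_) U≡P++M , Q≡M++V)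
  ...   | inj₂ (M , P≡U++M , V≡M++Q) = inj₂ (M , cong (p ∷_) P≡U++M , V≡M++Q)

  EndsWith : List X → X → Set
  EndsWith L x = ∃ λ L′ → L ≡ L′ ∷ʳ x

  StartsWith : List X → X → Set
  StartsWith L y = ∃ λ L′ → L ≡ y ∷ L′

  last-exists : ∀ L → L ≢ [] → ∃ (EndsWith L)
  last-exists L L≢[] with initLast L
  ... | []       = ⊥-elim (L≢[] refl)
  ... | L′ ∷ʳ′ x = x , L′ , refl

  head-exists : ∀ L → L ≢ [] → ∃ (StartsWith L)
  head-exists []      L≢[] = ⊥-elim (L≢[] refl)
  head-exists (y ∷ L) _    = y , L , refl

  ++-∷ʳ : ∀ (L M : List X) x → L ++ (M ∷ʳ x) ≡ (L ++ M) ∷ʳ x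
  ++-∷ʳ L M x = sym (++-assoc L M (x ∷ []))

module Segmentations {X I : Set} (R : I → I → Set) (B C : I → List X) (B≢[] : ∀ i → B i ≢ []) where

  -- A boundary of the B-segmentation lying strictly inside a C-segment.
  Straddle : Set
  Straddle = Σ I λ a → Σ I λ b → Σ X λ x → Σ X λ y →
    R a b × EndsWith (B a) x × StartsWith (B b) y × (Consecutive x y (C a) ⊎ Consecutive x y (C b))

  -- Invariant: G is what the C-segments still have to cover of the B-segments up to B a,
  -- so G ends with the last entry x of B a.
  straddle-ahead : ∀ a l G x → Linked R (a ∷ l) → EndsWith (B a) x → EndsWith G x →
                   concat (map C l) ≡ G ++ concat (map B l) → Straddle
  straddle-ahead a [] G x _ _ (G′ , refl) eq with G′ | eq
  ... | []    | ()
  ... | _ ∷ _ | ()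
  straddle-ahead a (b ∷ l) G x (Rab ∷ linked) Ba≡x (G′ , refl) eq
    with ++-split (C b) (concat (map C l)) (G′ ∷ʳ x) (B b ++ concat (map B l)) eq
  ... | inj₁ (M , _ , rest) with last-exists (B b) (B≢[] b)
  ...   | x′ , Bb′ , Bb≡ = straddle-ahead b l (M ++ B b) x′ linked (Bb′ , Bb≡)
                             (M ++ Bb′ , trans (cong (M ++_) Bb≡) (++-∷ʳ M Bb′ x′))
                             (trans rest (sym (++-assoc M (B b) _)))
  straddle-ahead a (b ∷ l) G x (Rab ∷ linked) Ba≡x (G′ , refl) eq | inj₂ ([] , _ , rest)
    with last-exists (B b) (B≢[] b)
  ... | x′ , Bb′ , Bb≡ = straddle-ahead b l (B b) x′ linked (Bb′ , Bb≡) (Bb′ , Bb≡) (sym rest)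
  straddle-ahead a (b ∷ l) G x (Rab ∷ linked) Ba≡x (G′ , refl) eq | inj₂ (y ∷ M , Cb≡ , rest)
    with head-exists (B b) (B≢[] b)
  ... | y′ , Bb′ , Bb≡ with ∷-injectiveˡ (trans (sym (cong (_++ concat (map B l)) Bb≡)) rest)
  ...   | refl = a , b , x , y , Rab , Ba≡x , (Bb′ , Bb≡) ,
                 inj₂ (G′ , M , trans Cb≡ (++-assoc G′ (x ∷ []) (y ∷ M)))

  segments-align : ∀ l → Linked R l → concat (map B l) ≡ concat (map C l) →
                   All (λ i → length (C i) ≡ length (B i)) l ⊎ Straddle
  segments-align [] _ _ = inj₁ []
  segments-align (j ∷ l) linked eq with ++-split (B j) (concat (map B l)) (C j) (concat (map C l)) eq
  ... | inj₁ ([] , Cj≡ , rest) with segments-align l (Linked.tail linked) rest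
  ...   | inj₁ aligned = inj₁ (cong length (trans Cj≡ (++-identityʳ (B j))) ∷ aligned)
  ...   | inj₂ straddle = inj₂ straddle
  segments-align (j ∷ []) linked eq | inj₁ (y ∷ M , _ , ())
  segments-align (j ∷ b ∷ l) (Rjb ∷ _) eq | inj₁ (y ∷ M , Cj≡ , rest)
    with head-exists (B b) (B≢[] b) | last-exists (B j) (B≢[] j)
  ... | y′ , Bb′ , Bb≡ | x , Bj′ , Bj≡ with ∷-injectiveˡ (trans (sym (cong (_++ concat (map B l)) Bb≡)) rest)
  ...   | refl = inj₂ (j , b , x , y , Rjb , (Bj′ , Bj≡) , (Bb′ , Bb≡) ,
                       inj₁ (Bj′ , M , trans Cj≡ (trans (cong (_++ y ∷ M) Bj≡)
                                                         (++-assoc Bj′ (x ∷ []) (y ∷ M)))))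
  segments-align (j ∷ l) linked eq | inj₂ ([] , Bj≡ , rest) with segments-align l (Linked.tail linked) (sym rest)
  ... | inj₁ aligned = inj₁ (cong length (sym (trans Bj≡ (++-identityʳ (C j)))) ∷ aligned)
  ... | inj₂ straddle = inj₂ straddle
  segments-align (j ∷ l) linked eq | inj₂ (m ∷ M , Bj≡ , rest) with last-exists (m ∷ M) (λ ())
  ... | x , G′ , G≡ = inj₂ (straddle-ahead j l (m ∷ M) x linked
                                            (C j ++ G′ , trans Bj≡ (trans (cong (C j ++_) G≡) (++-∷ʳ (C j) G′ x)))
                                            (G′ , G≡) rest)


-- Uniqueness of the filling vector

FillingSize : Deco → ℕ → Set
FillingSize plus  n = 2 ≤ n
FillingSize minus n = 2 ≤ n
FillingSize dot   n = n ≡ 1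

fillingSize-positive : ∀ d {n} → FillingSize d n → 1 ≤ n
fillingSize-positive plus  2≤n = ≤-trans (s≤s z≤n) 2≤n
fillingSize-positive minus 2≤n = ≤-trans (s≤s z≤n) 2≤n
fillingSize-positive dot   refl = ≤-refl

fillingVector-size : (p : Peg) {v : Fin (len p) → ℕ} → FillingVector p v → ∀ i → FillingSize (deco p i) (v i)
fillingVector-size p fills i with deco p i in d≡
... | plus  = proj₂ (fills i) (λ d≡dot → case trans (sym d≡) d≡dot of λ ())
... | minus = proj₂ (fills i) (λ d≡dot → case trans (sym d≡) d≡dot of λ ())
... | dot   = proj₁ (fills i) d≡

fillingVector-positive : (p : Peg) {v : Fin (len p) → ℕ} → FillingVector p v → ∀ i → 1 ≤ v i
fillingVector-positive p fills i = fillingSize-positive (deco p i) (fillingVector-size p fills i)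

ascending-∷ʳ : ∀ o n → ascending o (suc n) ≡ ascending o n ∷ʳ (o + n)
ascending-∷ʳ o zero    = cong (_∷ []) (sym (+-identityʳ o))
ascending-∷ʳ o (suc n) =
  cong (o ∷_) (trans (ascending-∷ʳ (suc o) n) (cong (ascending (suc o) n ∷ʳ_) (sym (+-suc o n))))

LastOfRun : Deco → ℕ → ℕ → ℕ → Set
LastOfRun plus  o n x = suc x ≡ o + n
LastOfRun minus o n x = x ≡ o
LastOfRun dot   o n x = x ≡ o

FirstOfRun : Deco → ℕ → ℕ → ℕ → Set
FirstOfRun plus  o n y = y ≡ o
FirstOfRun minus o n y = suc y ≡ o + n
FirstOfRun dot   o n y = y ≡ o

run-last : ∀ d o n {x L} → FillingSize d n → run d o n ≡ L ∷ʳ x → LastOfRun d o n x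
run-last plus o (suc n) {x} {L} _ eq =
  trans (cong suc (sym (∷ʳ-injectiveʳ (ascending o n) L (trans (sym (ascending-∷ʳ o n)) eq)))) (sym (+-suc o n))
run-last minus o (suc n) {x} {L} _ eq =
  sym (∷ʳ-injectiveʳ (reverse (ascending (suc o) n)) L (trans (sym (unfold-reverse o (ascending (suc o) n))) eq))
run-last dot o (suc zero) {x} {L} _ eq = sym (∷ʳ-injectiveʳ [] L eq)

run-first : ∀ d o n {y L} → FillingSize d n → run d o n ≡ y ∷ L → FirstOfRun d o n y
run-first plus  o (suc n) _ eq = sym (∷-injectiveˡ eq)
run-first dot   o (suc n) _ eq = sym (∷-injectiveˡ eq)
run-first minus o (suc n) {y} {L} _ eq = trans (cong suc (sym (∷-injectiveˡ top-first))) (sym (+-suc o n))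
  where
  top-first : o + n ∷ reverse (ascending o n) ≡ y ∷ L
  top-first = trans (sym (reverse-++ (ascending o n) (o + n ∷ []))) (trans (cong reverse (sym (ascending-∷ʳ o n))) eq)

top-∈ : ∀ {o n x} → 1 ≤ n → suc x ≡ o + n → o ≤ x × x < o + n
top-∈ {o} {suc n} _ suc-x≡ =
  subst (o ≤_) (sym (suc-injective (trans suc-x≡ (+-suc o n)))) (m≤m+n o n) , ≤-reflexive suc-x≡

suc≢+ : ∀ {o n} → 2 ≤ n → suc o ≢ o + n
suc≢+ {o} {n} 2≤n suc-o≡ with +-cancelˡ-≡ o 1 n (trans (+-comm o 1) suc-o≡)
... | refl = case 2≤n of λ { (s≤s ()) }

module _ {o n : ℕ} where

  last-∈ : ∀ d {x} → FillingSize d n → LastOfRun d o n x → o ≤ x × x < o + n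
  last-∈ plus  size suc-x≡ = top-∈ (fillingSize-positive plus size) suc-x≡
  last-∈ minus size refl   = ≤-refl , m<m+n o (fillingSize-positive minus size)
  last-∈ dot   size refl   = ≤-refl , m<m+n o (fillingSize-positive dot size)

  first-∈ : ∀ d {y} → FillingSize d n → FirstOfRun d o n y → o ≤ y × y < o + n
  first-∈ plus  size refl   = ≤-refl , m<m+n o (fillingSize-positive plus size)
  first-∈ minus size suc-y≡ = top-∈ (fillingSize-positive minus size) suc-y≡
  first-∈ dot   size refl   = ≤-refl , m<m+n o (fillingSize-positive dot size)

  last-top⇒ascending : ∀ d {x} → FillingSize d n → LastOfRun d o n x → suc x ≡ o + n → Ascending d
  last-top⇒ascending plus  _    _    _      = up-plus
  last-top⇒ascending dot   _    _    _      = up-dot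
  last-top⇒ascending minus size refl suc-o≡ = ⊥-elim (suc≢+ size suc-o≡)

  last-bottom⇒descending : ∀ d {x} → FillingSize d n → LastOfRun d o n x → x ≡ o → Descending d
  last-bottom⇒descending minus _    _      _    = down-minus
  last-bottom⇒descending dot   _    _      _    = down-dot
  last-bottom⇒descending plus  size suc-x≡ refl = ⊥-elim (suc≢+ size suc-x≡)

  first-bottom⇒ascending : ∀ d {y} → FillingSize d n → FirstOfRun d o n y → y ≡ o → Ascending d
  first-bottom⇒ascending plus  _    _      _    = up-plus
  first-bottom⇒ascending dot   _    _      _    = up-dot
  first-bottom⇒ascending minus size suc-y≡ refl = ⊥-elim (suc≢+ size suc-y≡)

  first-top⇒descending : ∀ d {y} → FillingSize d n → FirstOfRun d o n y → suc y ≡ o + n → Descending d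
  first-top⇒descending minus _    _    _      = down-minus
  first-top⇒descending dot   _    _    _      = down-dot
  first-top⇒descending plus  size refl suc-o≡ = ⊥-elim (suc≢+ size suc-o≡)

ascending-consecutive : ∀ o n {x y} → Consecutive x y (ascending o n) → y ≡ suc x
ascending-consecutive o (suc (suc n)) ([] , Q , eq) with ∷-injective eq
... | refl , rest = sym (∷-injectiveˡ rest)
ascending-consecutive o (suc n) (_ ∷ P , Q , eq) = ascending-consecutive (suc o) n (P , Q , proj₂ (∷-injective eq))
ascending-consecutive o zero          ([] , _ , ())
ascending-consecutive o zero          (_ ∷ _ , _ , ())
ascending-consecutive o (suc zero)    ([] , _ , ())

consecutive-reverse : ∀ {X : Set} {x y : X} L → Consecutive x y (reverse L) → Consecutive y x L
consecutive-reverse {x = x} {y} L (P , Q , eq) = reverse Q , reverse P , (begin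
  L                                       ≡⟨ reverse-involutive L ⟨
  reverse (reverse L)                     ≡⟨ cong reverse eq ⟩
  reverse (P ++ x ∷ y ∷ Q)                ≡⟨ reverse-++ P (x ∷ y ∷ Q) ⟩
  reverse (x ∷ y ∷ Q) ++ reverse P
    ≡⟨ cong (_++ reverse P) (trans (unfold-reverse x (y ∷ Q)) (cong (_∷ʳ x) (unfold-reverse y Q))) ⟩
  ((reverse Q ∷ʳ y) ∷ʳ x) ++ reverse P
    ≡⟨ trans (++-assoc (reverse Q ∷ʳ y) (x ∷ []) (reverse P)) (++-assoc (reverse Q) (y ∷ []) _) ⟩
  reverse Q ++ y ∷ x ∷ reverse P          ∎)
  where open ≡-Reasoning

consecutive-length : ∀ {X : Set} {x y : X} L → Consecutive x y L → 2 ≤ length L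
consecutive-length L (P , Q , refl) =
  subst (2 ≤_) (sym (length-++ P)) (≤-trans (s≤s (s≤s z≤n)) (m≤n+m _ (length P)))

run-consecutive : ∀ d o n {x y} → AdmissibleSize d n → Consecutive x y (run d o n) →
                  (d ≡ plus × y ≡ suc x) ⊎ (d ≡ minus × x ≡ suc y)
run-consecutive plus  o n _   xy = inj₁ (refl , ascending-consecutive o n xy)
run-consecutive minus o n _   xy = inj₂ (refl , ascending-consecutive o n (consecutive-reverse (ascending o n) xy))
run-consecutive dot   o n adm xy =
  case ≤-trans (consecutive-length (ascending o n) xy) (subst (_≤ 1) (sym (length-ascending o n)) (adm refl)) of λ
    { (s≤s ()) }

incPair : ∀ {d e} → Ascending d → Ascending e → d ≡ plus ⊎ e ≡ plus → IncPair d e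
incPair up-plus up-plus _ = pp
incPair up-plus up-dot  _ = pd
incPair up-dot  up-plus _ = dp
incPair up-dot  up-dot  (inj₁ ())
incPair up-dot  up-dot  (inj₂ ())

decPair : ∀ {d e} → Descending d → Descending e → d ≡ minus ⊎ e ≡ minus → DecPair d e
decPair down-minus down-minus _ = mm
decPair down-minus down-dot   _ = md
decPair down-dot   down-minus _ = dm
decPair down-dot   down-dot   (inj₁ ())
decPair down-dot   down-dot   (inj₂ ())

module Uniqueness (p : Peg) (no-bad : NoBadAdjacent p) {v : Fin (len p) → ℕ} (v-fills : FillingVector p v) where

  size : ∀ i → FillingSize (deco p i) (v i)
  size = fillingVector-size p v-fills

  positive : ∀ i → 1 ≤ v i
  positive = fillingVector-positive p v-fills

  block-nonempty : ∀ i → block p v i ≢ []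
  block-nonempty i eq = n≮0 (subst (0 <_) (trans (sym (length-block p v i)) (cong length eq)) (positive i))

  module Boundary {a b} (a→b : Next a b) {x y}
                  (x-last : EndsWith (block p v a) x) (y-first : StartsWith (block p v b) y) where

    private
      oa ob : ℕ
      oa = offset p v a
      ob = offset p v b
      last : LastOfRun (deco p a) oa (v a) x
      last = run-last (deco p a) oa (v a) (size a) (trans (sym (block≡run p v a)) (proj₂ x-last))
      first : FirstOfRun (deco p b) ob (v b) y
      first = run-first (deco p b) ob (v b) (size b) (trans (sym (block≡run p v b)) (proj₂ y-first))
      x∈a : oa ≤ x × x < oa + v a
      x∈a = last-∈ (deco p a) (size a) last
      y∈b : ob ≤ y × y < ob + v b
      y∈b = first-∈ (deco p b) (size b) first
      a≢b : a ≢ b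
      a≢b a≡b = 1+n≢n (sym (trans (cong toℕ a≡b) a→b))
      direction : ∀ {w} → Admissible p w → ∀ c → Consecutive x y (block p w c) →
                  (deco p c ≡ plus × y ≡ suc x) ⊎ (deco p c ≡ minus × x ≡ suc y)
      direction {w} w-adm c xy =
        run-consecutive (deco p c) (offset p w c) (w c) (w-adm c) (subst (Consecutive x y) (block≡run p w c) xy)

    not-ascending : y ≡ suc x → deco p a ≡ plus ⊎ deco p b ≡ plus → ⊥
    not-ascending y≡1+x some-plus with <-cmp (val p a) (val p b)
    ... | tri≈ _ a≡b _ = a≢b (val-injective p a≡b)
    ... | tri> _ _ b<a = <⇒≱ (<-≤-trans (proj₂ y∈b) (≤-trans (offset-< p v b<a) (proj₁ x∈a)))
                             (subst (x ≤_) (sym y≡1+x) (n≤1+n x))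
    ... | tri< a<b _ _ =
      no-bad a b a→b (inj₁ (offset-gap p v positive a<b ob≡ , incPair ascending-a ascending-b some-plus))
      where
      y≡ob : y ≡ ob
      y≡ob = ≤-antisym (≤-trans (subst (_≤ oa + v a) (sym y≡1+x) (proj₂ x∈a)) (offset-< p v a<b)) (proj₁ y∈b)
      1+x≡ : suc x ≡ oa + v a
      1+x≡ = ≤-antisym (proj₂ x∈a) (subst (oa + v a ≤_) (trans (sym y≡ob) y≡1+x) (offset-< p v a<b))
      ob≡ : ob ≡ oa + v a
      ob≡ = trans (sym y≡ob) (trans y≡1+x 1+x≡)
      ascending-a : Ascending (deco p a)
      ascending-a = last-top⇒ascending (deco p a) (size a) last 1+x≡
      ascending-b : Ascending (deco p b)
      ascending-b = first-bottom⇒ascending (deco p b) (size b) first y≡ob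

    not-descending : x ≡ suc y → deco p a ≡ minus ⊎ deco p b ≡ minus → ⊥
    not-descending x≡1+y some-minus with <-cmp (val p a) (val p b)
    ... | tri≈ _ a≡b _ = a≢b (val-injective p a≡b)
    ... | tri< a<b _ _ = <⇒≱ (<-≤-trans (proj₂ x∈a) (≤-trans (offset-< p v a<b) (proj₁ y∈b)))
                             (subst (y ≤_) (sym x≡1+y) (n≤1+n y))
    ... | tri> _ _ b<a =
      no-bad a b a→b (inj₂ (offset-gap p v positive b<a oa≡ , decPair descending-a descending-b some-minus))
      where
      x≡oa : x ≡ oa
      x≡oa = ≤-antisym (≤-trans (subst (_≤ ob + v b) (sym x≡1+y) (proj₂ y∈b)) (offset-< p v b<a)) (proj₁ x∈a)
      1+y≡ : suc y ≡ ob + v b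
      1+y≡ = ≤-antisym (proj₂ y∈b) (subst (ob + v b ≤_) (trans (sym x≡oa) x≡1+y) (offset-< p v b<a))
      oa≡ : oa ≡ ob + v b
      oa≡ = trans (sym x≡oa) (trans x≡1+y 1+y≡)
      descending-a : Descending (deco p a)
      descending-a = last-bottom⇒descending (deco p a) (size a) last x≡oa
      descending-b : Descending (deco p b)
      descending-b = first-top⇒descending (deco p b) (size b) first 1+y≡

    not-inside : ∀ {w} → Admissible p w → Consecutive x y (block p w a) ⊎ Consecutive x y (block p w b) → ⊥
    not-inside {w} w-adm (inj₁ in-a) with direction w-adm a in-a
    ... | inj₁ (plus-a , y≡1+x)  = not-ascending y≡1+x (inj₁ plus-a)
    ... | inj₂ (minus-a , x≡1+y) = not-descending x≡1+y (inj₁ minus-a)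
    not-inside {w} w-adm (inj₂ in-b) with direction w-adm b in-b
    ... | inj₁ (plus-b , y≡1+x)  = not-ascending y≡1+x (inj₂ plus-b)
    ... | inj₂ (minus-b , x≡1+y) = not-descending x≡1+y (inj₂ minus-b)

  filling-vector-unique : ∀ {w} → Admissible p w → inflate p w ≡ inflate p v → ∀ i → w i ≡ v i
  filling-vector-unique {w} w-adm eq i
    with segments-align (allFin (len p)) (linked-tabulate (λ k → k) (λ _ _ next → next)) (sym eq)
    where open Segmentations Next (block p v) (block p w) block-nonempty
  ... | inj₁ aligned = trans (sym (length-block p w i)) (trans (tabulate⁻ aligned i) (length-block p v i))
  ... | inj₂ (a , b , x , y , a→b , x-last , y-first , inside) =
    ⊥-elim (Boundary.not-inside a→b x-last y-first w-adm inside)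


-- Absorbing an entry across a forbidden adjacency

moveMass : ∀ {n} (s e : Fin n) → (Fin n → ℕ) → Fin n → ℕ
moveMass s e v k with k Fin.≟ e | k Fin.≟ s
... | yes _ | _     = 0
... | no _  | yes _ = v s + v e
... | no _  | no _  = v k

module _ {n} (s e : Fin n) (v : Fin n → ℕ) where

  moveMass-target : moveMass s e v e ≡ 0
  moveMass-target with e Fin.≟ e
  ... | yes _   = refl
  ... | no e≢e  = ⊥-elim (e≢e refl)

  moveMass-source : s ≢ e → moveMass s e v s ≡ v s + v e
  moveMass-source s≢e with s Fin.≟ e | s Fin.≟ s
  ... | yes s≡e | _      = ⊥-elim (s≢e s≡e)
  ... | no _    | yes _  = refl
  ... | no _    | no s≢s = ⊥-elim (s≢s refl)

  moveMass-other : ∀ {k} → k ≢ s → k ≢ e → moveMass s e v k ≡ v k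
  moveMass-other {k} k≢s k≢e with k Fin.≟ e | k Fin.≟ s
  ... | yes k≡e | _       = ⊥-elim (k≢e k≡e)
  ... | no _    | yes k≡s = ⊥-elim (k≢s k≡s)
  ... | no _    | no _    = refl

Absorbs : (p : Peg) → Fin (len p) → Fin (len p) → Set
Absorbs p s e = ∀ v → Admissible p v → Admissible p (moveMass s e v) × inflate p (moveMass s e v) ≡ inflate p v

moveMass-admissible : (p : Peg) {s e : Fin (len p)} → deco p s ≢ dot →
                      ∀ {v} → Admissible p v → Admissible p (moveMass s e v)
moveMass-admissible p {s} {e} signed {v} adm k dot-k with k Fin.≟ e | k Fin.≟ s
... | yes _ | _        = z≤n
... | no _  | yes refl = ⊥-elim (signed dot-k)
... | no _  | no _     = adm k dot-k

incPair-signed : ∀ {d d′} → IncPair d d′ → d ≢ dot ⊎ d′ ≢ dot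
incPair-signed pp = inj₁ (λ ())
incPair-signed pd = inj₁ (λ ())
incPair-signed dp = inj₂ (λ ())

decPair-signed : ∀ {d d′} → DecPair d d′ → d ≢ dot ⊎ d′ ≢ dot
decPair-signed mm = inj₁ (λ ())
decPair-signed md = inj₁ (λ ())
decPair-signed dm = inj₂ (λ ())

module _ (p : Peg) {i j : Fin (len p)} (i→j : Next i j) (bad : BadAdjacent p i j) where

  absorbs-within-badAdjacent : ∀ {s e} → (s ≡ i × e ≡ j) ⊎ (s ≡ j × e ≡ i) → deco p s ≢ dot →
                               Absorbs p s e
  absorbs-within-badAdjacent {s} {e} s,e signed v adm =
    adm′ , sym (inflate-merge p i→j bad v (moveMass s e v) adm adm′ (λ k k≢i k≢j → sym (agree s,e k≢i k≢j))
                              (pair s,e))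
    where
    adm′ : Admissible p (moveMass s e v)
    adm′ = moveMass-admissible p signed adm
    i≢j : i ≢ j
    i≢j i≡j = 1+n≢n (sym (trans (cong toℕ i≡j) i→j))
    agree : (s ≡ i × e ≡ j) ⊎ (s ≡ j × e ≡ i) → ∀ {k} → k ≢ i → k ≢ j → moveMass s e v k ≡ v k
    agree (inj₁ (refl , refl)) k≢i k≢j = moveMass-other i j v k≢i k≢j
    agree (inj₂ (refl , refl)) k≢i k≢j = moveMass-other j i v k≢j k≢i
    pair : (s ≡ i × e ≡ j) ⊎ (s ≡ j × e ≡ i) → v i + v j ≡ moveMass s e v i + moveMass s e v j
    pair (inj₁ (refl , refl)) =
      sym (trans (cong₂ _+_ (moveMass-source i j v i≢j) (moveMass-target i j v)) (+-identityʳ (v i + v j)))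
    pair (inj₂ (refl , refl)) =
      sym (trans (cong₂ _+_ (moveMass-target j i v) (moveMass-source j i v (i≢j ∘ sym))) (+-comm (v j) (v i)))

  badAdjacent⇒absorbs : ∃₂ λ s e → Absorbs p s e
  badAdjacent⇒absorbs with signed bad
    where
    signed : BadAdjacent p i j → deco p i ≢ dot ⊎ deco p j ≢ dot
    signed (inj₁ (_ , inc)) = incPair-signed inc
    signed (inj₂ (_ , dec)) = decPair-signed dec
  ... | inj₁ i-signed = i , j , absorbs-within-badAdjacent (inj₁ (refl , refl)) i-signed
  ... | inj₂ j-signed = j , i , absorbs-within-badAdjacent (inj₂ (refl , refl)) j-signed


canonicalSize : Deco → ℕ
canonicalSize plus  = 2
canonicalSize minus = 2
canonicalSize dot   = 1

canonicalSize-≤1 : ∀ d → canonicalSize d ≤ 1 → d ≡ dot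
canonicalSize-≤1 dot   _ = refl
canonicalSize-≤1 plus  (s≤s ())
canonicalSize-≤1 minus (s≤s ())

canonicalFilling : (p : Peg) → Fin (len p) → ℕ
canonicalFilling p i = canonicalSize (deco p i)

canonicalFilling-fills : (p : Peg) → FillingVector p (canonicalFilling p)
canonicalFilling-fills p i with deco p i
... | plus  = (λ ()) , λ _ → ≤-refl
... | minus = (λ ()) , λ _ → ≤-refl
... | dot   = (λ _ → refl) , λ dot≢dot → ⊥-elim (dot≢dot refl)

fillingVector⇒admissible : (p : Peg) {v : Fin (len p) → ℕ} → FillingVector p v → Admissible p v
fillingVector⇒admissible p fills i dot-i = ≤-reflexive (proj₁ (fills i) dot-i)

noBadAdjacent⇒uniqueFillings : ∀ p → NoBadAdjacent p → UniqueFillings p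
noBadAdjacent⇒uniqueFillings p no-bad π (v , fills , v↦π) =
  v , fillingVector⇒admissible p fills , v↦π ,
  λ w adm w↦π → Uniqueness.filling-vector-unique p no-bad fills adm (trans w↦π (sym v↦π))

uniqueFillings⇒filling-vector-unique : ∀ p → UniqueFillings p → ∀ {v w} → FillingVector p v → Admissible p w →
                                       inflate p w ≡ inflate p v → ∀ k → w k ≡ v k
uniqueFillings⇒filling-vector-unique p unique {v} {w} fills adm w↦ k with unique (inflate p v) (v , fills , refl)
... | _ , _ , _ , only = trans (only w adm w↦ k) (sym (only v (fillingVector⇒admissible p fills) refl k))

uniqueFillings⇒noBadAdjacent : ∀ p → UniqueFillings p → NoBadAdjacent p
uniqueFillings⇒noBadAdjacent p unique i j i→j bad with badAdjacent⇒absorbs p i→j bad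
... | s , e , absorbs = n≮0 (subst (0 <_) (trans (sym (emptied-e≡ e)) (moveMass-target s e v)) v-positive)
  where
  v : Fin (len p) → ℕ
  v = canonicalFilling p
  fills : FillingVector p v
  fills = canonicalFilling-fills p
  v-positive : 0 < v e
  v-positive = fillingVector-positive p fills e
  absorbed : Admissible p (moveMass s e v) × inflate p (moveMass s e v) ≡ inflate p v
  absorbed = absorbs v (fillingVector⇒admissible p fills)
  emptied-e≡ : ∀ k → moveMass s e v k ≡ v k
  emptied-e≡ = uniqueFillings⇒filling-vector-unique p unique fills (proj₁ absorbed) (proj₂ absorbed)

length-pegList : ∀ p → length (pegList p) ≡ len p
length-pegList p = trans (length-map _ (allFin (len p))) (length-tabulate (λ x → x))

module Deletion {n} (σ : Fin (suc n) → Fin (suc n)) (σ-inj : Injective _≡_ _≡_ σ) (d : Fin (suc n) → Deco)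
                (e : Fin (suc n)) where

  p : Peg
  p = peg (suc n) σ σ-inj d

  private
    σe≢ : ∀ a → σ e ≢ σ (punchIn e a)
    σe≢ a eq = punchInᵢ≢i e a (σ-inj (sym eq))

  deleted : Peg
  deleted = peg n (λ a → punchOut (σe≢ a))
                  (λ {a} {b} eq → punchIn-injective e a b (σ-inj (punchOut-injective (σe≢ a) (σe≢ b) eq)))
                  (d ∘ punchIn e)

  deleted-order : ∀ a b → (val deleted a < val deleted b) ⇔ (val p (punchIn e a) < val p (punchIn e b))
  deleted-order a b = punchOut-<-⇔ (σe≢ a) (σe≢ b)

  deleted-contained : Contained deleted p
  deleted-contained = punchIn e , punchIn-strictlyIncreasing e , deleted-order , λ _ → inj₂ refl

  deleted-≢ : pegList deleted ≢ pegList p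
  deleted-≢ eq = 1+n≢n (sym (trans (sym (length-pegList deleted)) (trans (cong length eq) (length-pegList p))))

  deleted-⊇ : ∀ {s} → Absorbs p s e → ∀ π → InI p π → InI deleted π
  deleted-⊇ {s} absorbs π (v , adm , v↦π) = u , u-adm , (begin
    inflate deleted u          ≡⟨ Restrict.inflate-restrict deleted p (punchIn e) (punchIn-strictlyIncreasing e)
                                    deleted-order u (moveMass s e v) (λ _ → refl) outside u-adm (λ _ → inj₂ refl) ⟨
    inflate p (moveMass s e v) ≡⟨ proj₂ (absorbs v adm) ⟩
    inflate p v                ≡⟨ v↦π ⟩
    π                          ∎)
    where
    open ≡-Reasoning
    u : Fin n → ℕ
    u = moveMass s e v ∘ punchIn e
    u-adm : Admissible deleted u
    u-adm a = proj₁ (absorbs v adm) (punchIn e a)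
    outside : ∀ x → (∀ a → punchIn e a ≢ x) → moveMass s e v x ≡ 0
    outside x x∉ = trans (cong (moveMass s e v) (punchIn-misses-only e x∉)) (moveMass-target s e v)

compact⇒noBadAdjacent : ∀ p → Compact p → NoBadAdjacent p
compact⇒noBadAdjacent (peg zero _ _ _) _ ()
compact⇒noBadAdjacent p@(peg (suc n) σ σ-inj d) compact i j i→j bad with badAdjacent⇒absorbs p i→j bad
... | s , e , absorbs = compact deleted deleted-contained deleted-≢
                          (λ π → mk⇔ (contained⇒inflations-⊆ deleted-contained π) (deleted-⊇ absorbs π))
  where open Deletion σ σ-inj d e

module SameInflations (p t : Peg) (no-bad : NoBadAdjacent p)
                      (f : Fin (len t) → Fin (len p)) (f-inc : StrictlyIncreasing f)
                      (f-ord : ∀ a b → (val t a < val t b) ⇔ (val p (f a) < val p (f b)))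
                      (compatible : DecoCompatible t p f) (same : SameI t p) where

  private
    v : Fin (len p) → ℕ
    v = canonicalFilling p
    fills : FillingVector p v
    fills = canonicalFilling-fills p
    from-t : InI t (inflate p v)
    from-t = Equivalence.from (same (inflate p v)) (v , fillingVector⇒admissible p fills , refl)
    u : Fin (len t) → ℕ
    u = proj₁ from-t
    u-adm : Admissible t u
    u-adm = proj₁ (proj₂ from-t)
    u′ : Fin (len p) → ℕ
    u′ = extend f u
    u′∘f : ∀ a → u′ (f a) ≡ u a
    u′∘f = extend-∘ f u (strictlyIncreasing⇒injective f-inc)
    u′≡v : ∀ x → u′ x ≡ v x
    u′≡v = Uniqueness.filling-vector-unique p no-bad fills (extend-admissible t p compatible u-adm)
             (trans (Restrict.inflate-restrict t p f f-inc f-ord u u′ u′∘f (extend-outside f u) u-adm compatible)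
                    (proj₂ (proj₂ from-t)))

  f-onto : ∀ x → ∃ λ a → f a ≡ x
  f-onto x = extend-hit f u x (subst (1 ≤_) (sym (u′≡v x)) (fillingVector-positive p fills x))

  val-agree : ∀ a → val p (f a) ≡ val t a
  val-agree = orderIsomorphic⇒toℕ-≡ (ρ-inj t) ρ∘f-onto f-ord
    where
    ρ∘f-onto : ∀ z → ∃ λ a → ρ p (f a) ≡ z
    ρ∘f-onto z with injective⇒surjective (ρ-inj p) z
    ... | x , ρx≡z with f-onto x
    ...   | a , fa≡x = a , trans (cong (ρ p) fa≡x) ρx≡z

  deco-agree : ∀ a → deco t a ≡ deco p (f a)
  deco-agree a with compatible a
  ... | inj₂ same-a = same-a
  ... | inj₁ dot-a  = trans dot-a (sym (canonicalSize-≤1 (deco p (f a)) u≤1))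
    where
    u≤1 : canonicalSize (deco p (f a)) ≤ 1
    u≤1 = subst (_≤ 1) (trans (sym (u′∘f a)) (u′≡v (f a))) (u-adm a dot-a)

  pegList-≡ : pegList t ≡ pegList p
  pegList-≡ = begin
    pegList t                             ≡⟨ map-tabulate (λ x → x) _ ⟩
    tabulate (λ a → val t a , deco t a)   ≡⟨ tabulate-cong-toℕ _ _ (strictlyIncreasing-onto⇒equal-size f-inc f-onto)
                                                                 entries-agree ⟩
    tabulate (λ x → val p x , deco p x)   ≡⟨ map-tabulate (λ x → x) _ ⟨
    pegList p                             ∎
    where
    open ≡-Reasoning
    entries-agree : ∀ a x → toℕ a ≡ toℕ x → (val t a , deco t a) ≡ (val p x , deco p x)
    entries-agree a x a≡x with toℕ-injective (trans (strictlyIncreasing-onto⇒toℕ-preserving f-inc f-onto a) a≡x)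
    ... | refl = cong₂ _,_ (sym (val-agree a)) (deco-agree a)

noBadAdjacent⇒compact : ∀ p → NoBadAdjacent p → Compact p
noBadAdjacent⇒compact p no-bad t (f , f-inc , f-ord , compatible) t≢p same =
  t≢p (SameInflations.pegList-≡ p t no-bad f f-inc f-ord compatible same)

proposition4p12 : (p : Peg) → (Compact p ⇔ NoBadAdjacent p) × (NoBadAdjacent p ⇔ UniqueFillings p)
proposition4p12 p = mk⇔ (compact⇒noBadAdjacent p) (noBadAdjacent⇒compact p)
                  , mk⇔ (noBadAdjacent⇒uniqueFillings p) (uniqueFillings⇒noBadAdjacent p)
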